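{- Let $\mathcal{F}$ be an $n$-periodic infinite frieze pattern of Type $\Lambda_{p_1,\ldots,p_s}$ realized by a dissection $\mathcal{D}$ of $A_{n,m}$ or $S_n$, with universal cover $I$ and covering map $\rho$. Let $w=(\mathcal{P}_{i+1},\ldots,\mathcal{P}_{i+n})\in\mathcal{M}_{i,i+n+1}$ and $j\in\mathbb{Z}$, and let $u=(\mathcal{Q}_{j+1},\ldots,\mathcal{Q}_{j+n})\in\mathcal{M}_{j,j+n+1}$ be its cyclic shift, i.e. for each $\ell$, $\mathcal{Q}_\ell$ is the lift incident to $u_\ell$ of the corner $\rho(\mathcal{P}_k)$ at $v_{\ell\bmod n}$, where $k\in\{i+1,\ldots,i+n\}$, $k\equiv\ell\pmod n$. Then $wt_A(w)=wt_A(u)$. In particular, for all $i,j\in\mathbb{Z}$, $\sum_{w\in\mathcal{M}_{i,i+n+1}}wt_A(w)=\sum_{u\in\mathcal{M}_{j,j+n+1}}wt_A(u)$.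
   Context: $\lambda_p=2\cos(\pi/p)$; $U_{ -1}=0$, $U_0=1$, $U_k(x)=xU_{k-1}(x)-U_{k-2}(x)$. $A_{n,m}$: annulus with $n$ outer marked points $v_1,\ldots,v_n$ (counterclockwise) and $m$ inner ones; $S_n$: disc with $n$ boundary marked points and one puncture. A dissection is a set of non-crossing arcs dividing the surface into polygons (subgons), no arc joining two inner points; it realizes the frieze pattern (array $(m_{i,j})_{j\ge i}$, $m_{i,i}=0$, $m_{i,i+1}=1$, $m_{i-1,j}m_{i,j+1}-m_{i,j}m_{i+1,j+1}=1$) if $m_{i-1,i+1}=\sum\lambda_{|\mathcal{P}|}$ over subgons incident to $v_i$ (by corners). Type $\Lambda_{p_1,\ldots,p_s}$: quiddity entries are sums of positive integer multiples of the $\lambda_{p_k}$. Universal cover $I$: for $A_{n,m}$, cut along a bridging arc and glue $\mathbb{Z}$ copies along it, yielding a dissected infinite strip with lower marked points $u_i$ ($i\in\mathbb{Z}$) over $v_{i\bmod n}$; for $S_n$, a strip with lower points $u_i$ and a point $+\infty$, arcs from $v_a$ to the puncture lifting to arcs from all $u_i$ with $i\equiv a$ to $+\infty$, regions between them dissected as in $S_n$. The covering map $\rho$ maps subgons of $I$ to subgons of $\mathcal{D}$ preserving size, and subgons of $I$ incident to $u_i$ correspond bijectively to corners of subgons at $v_{i\bmod n}$. $\mathcal{M}_{i,i+n+1}$: sequences $(\mathcal{P}_{i+1},\ldots,\mathcal{P}_{i+n})$ with $\mathcal{P}_k$ a subgon of $I$ incident to $u_k$. Annulus weight: $N_{\mathcal{P}}$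 = number of entries whose image under $\rho$ is $\mathcal{P}\in\mathcal{D}$; $wt_A=0$ if some $N_{\mathcal{P}}>|\mathcal{P}|-2$, else $wt_A=\prod_{\mathcal{P}\in\mathcal{D}}U_{N_{\mathcal{P}}}(\lambda_{|\mathcal{P}|})$. -}

module Defs where

open import Level using (Level)
open import Algebra.Bundles using (CommutativeRing)
open import Data.Bool using (if_then_else_)
open import Data.Nat as ℕ using (ℕ; zero; suc; _∸_; _<?_; NonZero)
open import Data.Integer as ℤ using (ℤ; +_)
open import Data.Integer.DivMod using (_%ℕ_; n%ℕd<d)
open import Data.Fin as Fin using (Fin; fromℕ<; toℕ)
open import Data.Fin.Properties using (any?)
open import Data.List as List using (List; []; _∷_; concatMap; map; allFin; foldr)
open import Data.List.Membership.Propositional using (_∈_)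
open import Relation.Nullary.Decidable using (⌊_⌋)
open import Relation.Binary.PropositionalEquality using (_≡_; subst)

-- Combinatorial data of a dissection D of A_{n,m} or S_n, as far as the
-- outer marked points v_1..v_n are concerned.
--   * subgons are Fin nsub, with their sizes |P| (≥ 3, lying in ps: type
--     Λ_{p_1..p_s});
--   * at each outer marked point v_a (a : Fin n, v_a = v_{toℕ a} mod n)
--     there are deg a corners (counted with multiplicity), and
--     corner a c is the subgon having that corner.
-- Subgons of the universal cover I incident to u_k correspond bijectively
-- to corners at v_{k mod n}; we identify them via this bijection, and the
-- covering map ρ sends such a lift to the subgon `corner a c`.
record Dissection (n : ℕ) (ps : List ℕ) : Set where
  field
    nsub   : ℕ
    size   : Fin nsub → ℕ
    size≥3 : ∀ P → 3 ℕ.≤ size P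
    sizeΛ  : ∀ P → size P ∈ ps
    deg    : Fin n → ℕ
    corner : (a : Fin n) → Fin (deg a) → Fin nsub

vtx : (n : ℕ) .{{_ : NonZero n}} → ℤ → Fin n
vtx n k = fromℕ< (n%ℕd<d k n)

pos : ∀ {n} → ℤ → Fin n → ℤ
pos i t = i ℤ.+ + suc (toℕ t)

module _ {c ℓ : Level} (R : CommutativeRing c ℓ) where
  open CommutativeRing R

  U : ℕ → Carrier → Carrier
  U zero x = 1#
  U (suc zero) x = x
  U (suc (suc k)) x = x * U (suc k) x + - U k x

  sumFin : (k : ℕ) → (Fin k → Carrier) → Carrier
  sumFin zero f = 0#
  sumFin (suc k) f = f Fin.zero + sumFin k (λ t → f (Fin.suc t))

  prodFin : (k : ℕ) → (Fin k → Carrier) → Carrier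
  prodFin zero f = 1#
  prodFin (suc k) f = f Fin.zero * prodFin k (λ t → f (Fin.suc t))

  sumList : List Carrier → Carrier
  sumList = foldr _+_ 0#

  record RealizedFrieze {n ps} .{{_ : NonZero n}} (D : Dissection n ps)
                        (λ' : ℕ → Carrier) (m : ℤ → ℤ → Carrier) : Set (c Level.⊔ ℓ) where
    open Dissection D
    field
      diag     : ∀ i → m i i ≈ 0#
      superdiag : ∀ i → m i (i ℤ.+ + 1) ≈ 1#
      unimod   : ∀ i j → i ℤ.≤ j →
        m (i ℤ.- + 1) j * m i (j ℤ.+ + 1) + - (m i j * m (i ℤ.+ + 1) (j ℤ.+ + 1)) ≈ 1#
      periodic : ∀ i j → i ℤ.≤ j → m (i ℤ.+ + n) (j ℤ.+ + n) ≈ m i j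
      quiddity : ∀ i → m (i ℤ.- + 1) (i ℤ.+ + 1)
                        ≈ sumFin (deg (vtx n i)) (λ c' → λ' (size (corner (vtx n i) c')))

module _ {n ps} .{{_ : NonZero n}} (D : Dissection n ps) where
  open Dissection D

  -- M_{i,i+n+1}: w t is the lift (≅ corner at v_{k mod n}) chosen at u_k, k = i+1+t
  M : ℤ → Set
  M i = (t : Fin n) → Fin (deg (vtx n (pos i t)))

  ρ : ∀ i → M i → Fin n → Fin nsub
  ρ i w t = corner (vtx n (pos i t)) (w t)

  countFin : (k : ℕ) → (Fin k → Fin nsub) → Fin nsub → ℕ
  countFin zero f P = 0
  countFin (suc k) f P =
    (if ⌊ f Fin.zero Fin.≟ P ⌋ then 1 else 0) ℕ.+ countFin k (λ t → f (Fin.suc t)) P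

  N : ∀ i → M i → Fin nsub → ℕ
  N i w P = countFin n (ρ i w) P

  -- u is the cyclic shift of w: entries over the same residue class agree
  IsShift : ∀ i j → M i → M j → Set
  IsShift i j w u = ∀ (t t' : Fin n) (p : vtx n (pos i t) ≡ vtx n (pos j t')) →
                    subst (λ a → Fin (deg a)) p (w t) ≡ u t'

  allChoices : (k : ℕ) (d : Fin k → ℕ) → List ((t : Fin k) → Fin (d t))
  allChoices zero d = (λ ()) ∷ []
  allChoices (suc k) d =
    concatMap (λ x → map (λ f → λ { Fin.zero → x ; (Fin.suc t) → f t })
                         (allChoices k (λ t → d (Fin.suc t))))
              (allFin (d Fin.zero))

  allM : ∀ i → List (M i)
  allM i = allChoices n (λ t → deg (vtx n (pos i t)))

  module _ {c ℓ : Level} (R : CommutativeRing c ℓ) (λ' : ℕ → CommutativeRing.Carrier R) where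
    open CommutativeRing R

    wtA : ∀ i → M i → Carrier
    wtA i w = if ⌊ any? (λ P → size P ∸ 2 <? N i w P) ⌋
              then 0#
              else prodFin R nsub (λ P → U R (N i w P) (λ' (size P)))

{-# OPTIONS --safe #-}
-- Since k ↦ v_{k mod n} is n-periodic, the residues over the window i+1, …, i+n are a
-- rotation, hence a permutation, of those over any other window of n consecutive positions.
-- A cyclic shift therefore permutes the list of subgons ρ(𝒫ₖ), and wt_A only sees the
-- multiplicities N_𝒫 of that list. Summing over M_{i,i+n+1} is an iterated sum, one sum per
-- position over the corners at its residue, of a function of the multiset of chosen subgons;
-- permuting the positions merely interchanges these sums, so the total is independent of i.
module Submission where

open import Defs
open import Level using (Level)
open import Algebra.Bundles using (CommutativeRing)
open import Data.Nat using (ℕ; NonZero)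
open import Data.Integer using (ℤ)
open import Data.List using (List; map)
open import Data.Product using (_×_)

open import Data.Nat as ℕ using (zero; suc; _∸_; _%_; _<?_; z≤n; s≤s)
import Data.Nat.Properties as ℕ
open import Data.Nat.DivMod using (n%n≡0; m<n⇒m%n≡m; m%n≤n; [m+n]%n≡m%n)
open import Data.Integer as ℤ using (+_; -[1+_]; _%ℕ_; _⊖_)
import Data.Integer.Properties as ℤ
open import Data.Fin as Fin using (Fin)
open import Data.Fin.Properties using (fromℕ<-cong; any?)
open import Data.List as List using ([]; _∷_; _∷ʳ_; _++_; tabulate; concatMap; allFin; filter; length)
import Data.List.Properties as List
open import Data.List.Membership.Propositional.Properties using (∈-tabulate⁺; ∈-tabulate⁻)
open import Data.List.Relation.Binary.Permutation.Propositional
  using (_↭_; ↭-refl; ↭-sym; ↭-trans; module PermutationReasoning)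
import Data.List.Relation.Binary.Permutation.Propositional as ↭
open import Data.List.Relation.Binary.Permutation.Propositional.Properties
  using (map⁺; ∷↭∷ʳ; ∈-resp-↭; ↭-length; filter-↭)
open import Data.Product using (Σ; ∃; _,_; proj₁; proj₂)
open import Data.Empty using (⊥-elim)
open import Data.Bool using (if_then_else_)
open import Function using (id; _∘_; _⇔_; mk⇔)
open import Relation.Binary.Definitions using (DecidableEquality; tri<; tri≈; tri>)
open import Relation.Binary.PropositionalEquality as ≡ using (_≡_; refl; cong; cong₂; module ≡-Reasoning)
open import Relation.Nullary using (Dec; yes; no)
open import Relation.Nullary.Decidable using (⌊_⌋; isYes≗does; does-⇔)

module _ (n : ℕ) .{{_ : NonZero n}} where
  open ≡-Reasoning

  -[1+a]%ℕn≡[n∸[1+a]%n]%n : ∀ a → -[1+ a ] %ℕ n ≡ (n ∸ suc a % n) % n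
  -[1+a]%ℕn≡[n∸[1+a]%n]%n a with suc a % n | m%n≤n (suc a) n
  ... | zero  | _   = ≡.sym (n%n≡0 n)
  ... | suc r | r<n = ≡.sym (m<n⇒m%n≡m (ℕ.∸-monoʳ-< {o = 0} (s≤s z≤n) r<n))

  [i+n]%ℕn≡i%ℕn : ∀ i → (i ℤ.+ + n) %ℕ n ≡ i %ℕ n
  [i+n]%ℕn≡i%ℕn (+ a) = [m+n]%n≡m%n a n
  [i+n]%ℕn≡i%ℕn -[1+ a ] with ℕ.<-cmp (suc a) n
  ... | tri< a<n _ _ = begin
    (n ⊖ suc a) %ℕ n      ≡⟨ cong (_%ℕ n) (ℤ.⊖-≥ (ℕ.<⇒≤ a<n)) ⟩
    (n ∸ suc a) % n       ≡⟨ cong (λ s → (n ∸ s) % n) (m<n⇒m%n≡m a<n) ⟨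
    (n ∸ suc a % n) % n   ≡⟨ -[1+a]%ℕn≡[n∸[1+a]%n]%n a ⟨
    -[1+ a ] %ℕ n         ∎
  ... | tri≈ _ refl _ = begin
    (n ⊖ n) %ℕ n          ≡⟨ cong (_%ℕ n) (ℤ.n⊖n≡0 n) ⟩
    0                     ≡⟨ n%n≡0 n ⟨
    (n ∸ 0) % n           ≡⟨ cong (λ s → (n ∸ s) % n) (n%n≡0 n) ⟨
    (n ∸ n % n) % n       ≡⟨ -[1+a]%ℕn≡[n∸[1+a]%n]%n a ⟨
    -[1+ a ] %ℕ n         ∎
  ... | tri> _ _ a>n = begin
    (n ⊖ suc a) %ℕ n                ≡⟨ cong (_%ℕ n) (ℤ.⊖-< a>n) ⟩
    ℤ.- + (suc a ∸ n) %ℕ n          ≡⟨ cong (λ x → ℤ.- + x %ℕ n) (ℕ.+-∸-assoc 1 (ℕ.≤-pred a>n)) ⟩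
    -[1+ a ∸ n ] %ℕ n               ≡⟨ -[1+a]%ℕn≡[n∸[1+a]%n]%n (a ∸ n) ⟩
    (n ∸ suc (a ∸ n) % n) % n       ≡⟨ cong (λ s → (n ∸ s) % n) [1+a∸n]%n≡[1+a]%n ⟩
    (n ∸ suc a % n) % n             ≡⟨ -[1+a]%ℕn≡[n∸[1+a]%n]%n a ⟨
    -[1+ a ] %ℕ n                   ∎
    where
    [1+a∸n]%n≡[1+a]%n : suc (a ∸ n) % n ≡ suc a % n
    [1+a∸n]%n≡[1+a]%n = begin
      suc (a ∸ n) % n         ≡⟨ [m+n]%n≡m%n (suc (a ∸ n)) n ⟨
      suc (a ∸ n ℕ.+ n) % n   ≡⟨ cong (λ x → suc x % n) (ℕ.m∸n+n≡m (ℕ.≤-pred a>n)) ⟩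
      suc a % n               ∎

  vtx-periodic : ∀ i → vtx n (i ℤ.+ + n) ≡ vtx n i
  vtx-periodic i = fromℕ<-cong _ _ ([i+n]%ℕn≡i%ℕn i) _ _

suc[i]+m≡i+[1+m] : ∀ i m → ℤ.suc i ℤ.+ + m ≡ i ℤ.+ + suc m
suc[i]+m≡i+[1+m] i m = begin
  (+ 1 ℤ.+ i) ℤ.+ + m   ≡⟨ cong (ℤ._+ + m) (ℤ.+-comm (+ 1) i) ⟩
  (i ℤ.+ + 1) ℤ.+ + m   ≡⟨ ℤ.+-assoc i (+ 1) (+ m) ⟩
  i ℤ.+ + suc m         ∎
  where open ≡-Reasoning

module Windows {a} {A : Set a} (h : ℤ → A) where

  window : ℤ → (k : ℕ) → List A
  window i k = tabulate (λ (t : Fin k) → h (pos i t))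

  window-suc : ∀ i k → window i (suc k) ≡ h (ℤ.suc i) ∷ window (ℤ.suc i) k
  window-suc i k = cong₂ _∷_ (cong h (ℤ.+-comm i (+ 1)))
    (List.tabulate-cong (λ t → cong h (≡.sym (suc[i]+m≡i+[1+m] i (suc (Fin.toℕ t))))))

  window-∷ʳ : ∀ i k → window i (suc k) ≡ window i k ∷ʳ h (i ℤ.+ + suc k)
  window-∷ʳ i zero = refl
  window-∷ʳ i (suc k) = begin
    window i (suc (suc k))                                          ≡⟨ window-suc i (suc k) ⟩
    h (ℤ.suc i) ∷ window (ℤ.suc i) (suc k)                         ≡⟨ cong (h (ℤ.suc i) ∷_) (window-∷ʳ (ℤ.suc i) k) ⟩
    h (ℤ.suc i) ∷ (window (ℤ.suc i) k ∷ʳ h (ℤ.suc i ℤ.+ + suc k))  ≡⟨ cong (λ x → h (ℤ.suc i) ∷ (window (ℤ.suc i) k ∷ʳ h x))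
                                                                             (suc[i]+m≡i+[1+m] i (suc k)) ⟩
    h (ℤ.suc i) ∷ window (ℤ.suc i) k ∷ʳ h (i ℤ.+ + suc (suc k))    ≡⟨ cong (_∷ʳ h (i ℤ.+ + suc (suc k))) (window-suc i k) ⟨
    window i (suc k) ∷ʳ h (i ℤ.+ + suc (suc k))                     ∎
    where open ≡-Reasoning

  window-sucℤ-↭ : ∀ n → (∀ i → h (i ℤ.+ + n) ≡ h i) → ∀ i → window (ℤ.suc i) n ↭ window i n
  window-sucℤ-↭ zero    _        i = ↭-refl
  window-sucℤ-↭ (suc k) periodic i = begin
    window (ℤ.suc i) (suc k)                      ≡⟨ window-∷ʳ (ℤ.suc i) k ⟩
    window (ℤ.suc i) k ∷ʳ h (ℤ.suc i ℤ.+ + suc k) ≡⟨ cong (window (ℤ.suc i) k ∷ʳ_) (periodic (ℤ.suc i)) ⟩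
    window (ℤ.suc i) k ∷ʳ h (ℤ.suc i)             ↭⟨ ∷↭∷ʳ _ _ ⟨
    h (ℤ.suc i) ∷ window (ℤ.suc i) k              ≡⟨ window-suc i k ⟨
    window i (suc k)                              ∎
    where open PermutationReasoning

  window-↭ : ∀ n → (∀ i → h (i ℤ.+ + n) ≡ h i) → ∀ i j → window i n ↭ window j n
  window-↭ n periodic i j = ↭-trans (↭-window₀ i) (↭-sym (↭-window₀ j))
    where
    step : ∀ i → window (ℤ.suc i) n ↭ window i n
    step = window-sucℤ-↭ n periodic

    ↭-window₀ : ∀ i → window i n ↭ window (+ 0) n
    ↭-window₀ (+ zero)      = ↭-refl
    ↭-window₀ (+ suc k)     = ↭-trans (step (+ k)) (↭-window₀ (+ k))
    ↭-window₀ -[1+ zero ]   = ↭-sym (step -[1+ zero ])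
    ↭-window₀ -[1+ suc k ]  = ↭-trans (↭-sym (step -[1+ suc k ])) (↭-window₀ -[1+ k ])

module _ {a b} {A : Set a} {B : Set b} (_≟_ : DecidableEquality B) where

  tabulate-↭-byKey : ∀ {k} (p q : Fin k → B) (f g : Fin k → A) →
                     tabulate p ↭ tabulate q → (∀ t t′ → p t ≡ q t′ → f t ≡ g t′) →
                     tabulate f ↭ tabulate g
  tabulate-↭-byKey {zero}  p q f g p↭q agree = ↭-refl
  tabulate-↭-byKey {suc k} p q f g p↭q agree = begin
    tabulate f             ≡⟨ List.tabulate-cong G∘p≗f ⟨
    tabulate (G ∘ p)       ≡⟨ List.map-tabulate p G ⟨
    map G (tabulate p)     ↭⟨ map⁺ G p↭q ⟩
    map G (tabulate q)     ≡⟨ List.map-tabulate q G ⟩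
    tabulate (G ∘ q)       ≡⟨ List.tabulate-cong G∘q≗g ⟩
    tabulate g             ∎
    where
    open PermutationReasoning

    key-in-q : ∀ t → ∃ λ t′ → p t ≡ q t′
    key-in-q t = ∈-tabulate⁻ (∈-resp-↭ p↭q (∈-tabulate⁺ {f = p} t))

    key-in-p : ∀ t′ → ∃ λ t → q t′ ≡ p t
    key-in-p t′ = ∈-tabulate⁻ (∈-resp-↭ (↭-sym p↭q) (∈-tabulate⁺ {f = q} t′))

    G : B → A
    G x with any? (λ t′ → q t′ ≟ x)
    ... | yes (t′ , _) = g t′
    ... | no _         = g Fin.zero

    G∘p≗f : ∀ t → G (p t) ≡ f t
    G∘p≗f t with any? (λ t′ → q t′ ≟ p t)
    ... | yes (t′ , q≡p) = ≡.sym (agree t t′ (≡.sym q≡p))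
    ... | no ∄t′         = ⊥-elim (∄t′ (let t′ , p≡q = key-in-q t in t′ , ≡.sym p≡q))

    G∘q≗g : ∀ t′ → G (q t′) ≡ g t′
    G∘q≗g t′ with any? (λ t″ → q t″ ≟ q t′)
    ... | yes (t″ , q≡q) = let t , q≡p = key-in-p t′ in
                           ≡.trans (≡.sym (agree t t″ (≡.trans (≡.sym q≡p) (≡.sym q≡q)))) (agree t t′ (≡.sym q≡p))
    ... | no ∄t″         = ⊥-elim (∄t″ (t′ , refl))

module _ {a} {A : Set a} (_≟_ : DecidableEquality A) where

  multiplicity : List A → A → ℕ
  multiplicity xs x = length (filter (_≟ x) xs)

  multiplicity-↭ : ∀ {xs ys} → xs ↭ ys → ∀ x → multiplicity xs x ≡ multiplicity ys x
  multiplicity-↭ xs↭ys x = ↭-length (filter-↭ (_≟ x) xs↭ys)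

module Sums {c ℓ} (R : CommutativeRing c ℓ) where
  open CommutativeRing R hiding (refl)
  open CommutativeRing R using () renaming (refl to ≈-refl)
  open import Algebra.Properties.CommutativeMonoid.Sum +-commutativeMonoid using (sum; sum-cong-≋; ∑-comm)

  sumList-++ : ∀ xs ys → sumList R (xs ++ ys) ≈ sumList R xs + sumList R ys
  sumList-++ []       ys = sym (+-identityˡ _)
  sumList-++ (x ∷ xs) ys = trans (+-congˡ (sumList-++ xs ys)) (sym (+-assoc _ _ _))

  sumList-map-concatMap : ∀ {a b} {A : Set a} {B : Set b} (F : B → Carrier) (g : A → List B) xs →
    sumList R (map F (concatMap g xs)) ≈ sumList R (map (λ x → sumList R (map F (g x))) xs)
  sumList-map-concatMap F g []       = ≈-refl
  sumList-map-concatMap F g (x ∷ xs) = begin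
    sumList R (map F (g x ++ concatMap g xs))                  ≡⟨ cong (sumList R) (List.map-++ F (g x) _) ⟩
    sumList R (map F (g x) ++ map F (concatMap g xs))          ≈⟨ sumList-++ (map F (g x)) _ ⟩
    sumList R (map F (g x)) + sumList R (map F (concatMap g xs)) ≈⟨ +-congˡ (sumList-map-concatMap F g xs) ⟩
    sumList R (map F (g x)) + sumList R (map (λ y → sumList R (map F (g y))) xs) ∎
    where open import Relation.Binary.Reasoning.Setoid setoid

  sumList-map-tabulate : ∀ {a} {A : Set a} {k} (g : Fin k → A) (F : A → Carrier) →
                         sumList R (map F (tabulate g)) ≡ sum (F ∘ g)
  sumList-map-tabulate {k = zero}  g F = refl
  sumList-map-tabulate {k = suc k} g F = cong (λ s → F (g Fin.zero) + s) (sumList-map-tabulate (g ∘ Fin.suc) F)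

  Family : ∀ {x} → Set x → Set x
  Family X = Σ ℕ (λ d → Fin d → X)

  sumChoices : ∀ {x} {X : Set x} → List (Family X) → (List X → Carrier) → Carrier
  sumChoices []             H = H []
  sumChoices ((d , x) ∷ ss) H = sum (λ t → sumChoices ss (λ L → H (x t ∷ L)))

  sumChoices-cong : ∀ {x} {X : Set x} ss {H H′ : List X → Carrier} →
                    (∀ L → H L ≈ H′ L) → sumChoices ss H ≈ sumChoices ss H′
  sumChoices-cong []             H≈H′ = H≈H′ []
  sumChoices-cong ((d , x) ∷ ss) H≈H′ = sum-cong-≋ {d} (λ t → sumChoices-cong ss (λ L → H≈H′ (x t ∷ L)))

  sumChoices-↭ : ∀ {x} {X : Set x} {ss ss′ : List (Family X)} {H : List X → Carrier} →
                 (∀ {L L′} → L ↭ L′ → H L ≈ H L′) → ss ↭ ss′ → sumChoices ss H ≈ sumChoices ss′ H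
  sumChoices-↭ H-↭ ↭.refl = ≈-refl
  sumChoices-↭ H-↭ (↭.prep (d , x) p) =
    sum-cong-≋ {d} (λ t → sumChoices-↭ (λ q → H-↭ (↭.prep _ q)) p)
  sumChoices-↭ {ss′ = _ ∷ _ ∷ ss′} H-↭ (↭.swap (d₁ , x₁) (d₂ , x₂) p) =
    trans (∑-comm {d₁} {d₂} _) (sum-cong-≋ {d₂} λ t₂ → sum-cong-≋ {d₁} λ t₁ →
      trans (sumChoices-↭ (λ q → H-↭ (↭.prep _ (↭.prep _ q))) p)
            (sumChoices-cong ss′ (λ L → H-↭ (↭.swap _ _ ↭-refl))))
  sumChoices-↭ H-↭ (↭.trans p q) = trans (sumChoices-↭ H-↭ p) (sumChoices-↭ H-↭ q)

module _ {n ps} .{{_ : NonZero n}} (D : Dissection n ps) {c ℓ} (R : CommutativeRing c ℓ) where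
  open Dissection D
  open CommutativeRing R hiding (refl)
  open import Algebra.Properties.CommutativeMonoid.Sum +-commutativeMonoid using (sum; sum-cong-≋)
  open Sums R

  sumList-allChoices : ∀ {x} {X : Set x} k (s : Fin k → Family X)
    (F : ((t : Fin k) → Fin (proj₁ (s t))) → Carrier) (H : List X → Carrier) →
    (∀ w → F w ≈ H (tabulate (λ t → proj₂ (s t) (w t)))) →
    sumList R (map F (allChoices D k (proj₁ ∘ s))) ≈ sumChoices (tabulate s) H
  sumList-allChoices zero    s F H F≈H = trans (+-identityʳ _) (F≈H _)
  sumList-allChoices (suc k) s F H F≈H =
    trans (sumList-map-concatMap F _ (allFin d₀))
      (trans (reflexive (sumList-map-tabulate {k = d₀} id _))
        (sum-cong-≋ {d₀} λ x → trans (reflexive (cong (sumList R) (≡.sym (List.map-∘ {g = F} rest))))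
                                     (sumList-allChoices k (s ∘ Fin.suc) _ (λ L → H (proj₂ (s Fin.zero) x ∷ L)) (λ w → F≈H _))))
    where
    d₀ = proj₁ (s Fin.zero)
    rest = allChoices D k (proj₁ ∘ s ∘ Fin.suc)

  prodFin-cong : ∀ k {f g : Fin k → Carrier} → (∀ t → f t ≡ g t) → prodFin R k f ≡ prodFin R k g
  prodFin-cong zero    f≗g = refl
  prodFin-cong (suc k) f≗g = cong₂ _*_ (f≗g Fin.zero) (prodFin-cong k (f≗g ∘ Fin.suc))

  module _ (λ′ : ℕ → Carrier) where

    Overfull : (Fin nsub → ℕ) → Set
    Overfull N = ∃ λ P → size P ∸ 2 ℕ.< N P

    overfull? : ∀ N → Dec (Overfull N)
    overfull? N = any? (λ P → size P ∸ 2 <? N P)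

    weight : (Fin nsub → ℕ) → Carrier
    weight N = if ⌊ overfull? N ⌋ then 0# else prodFin R nsub (λ P → U R (N P) (λ′ (size P)))

    Overfull-cong : ∀ {N N′} → (∀ P → N P ≡ N′ P) → Overfull N ⇔ Overfull N′
    Overfull-cong N≗N′ = mk⇔ (λ (P , <N) → P , ≡.subst (size P ∸ 2 ℕ.<_) (N≗N′ P) <N)
                             (λ (P , <N′) → P , ≡.subst (size P ∸ 2 ℕ.<_) (≡.sym (N≗N′ P)) <N′)

    weight-cong : ∀ {N N′} → (∀ P → N P ≡ N′ P) → weight N ≡ weight N′
    weight-cong {N} {N′} N≗N′ = cong₂ (λ b x → if b then 0# else x) overfull≡
      (prodFin-cong nsub (λ P → cong (λ k → U R k (λ′ (size P))) (N≗N′ P)))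
      where
      overfull≡ : ⌊ overfull? N ⌋ ≡ ⌊ overfull? N′ ⌋
      overfull≡ = ≡.trans (isYes≗does (overfull? N))
                    (≡.trans (does-⇔ (Overfull-cong N≗N′) (overfull? N) (overfull? N′))
                             (≡.sym (isYes≗does (overfull? N′))))

    listWeight : List (Fin nsub) → Carrier
    listWeight L = weight (multiplicity Fin._≟_ L)

    listWeight-↭ : ∀ {L L′} → L ↭ L′ → listWeight L ≈ listWeight L′
    listWeight-↭ L↭L′ = reflexive (weight-cong (multiplicity-↭ Fin._≟_ L↭L′))

    countFin-tabulate : ∀ k f P → countFin D k f P ≡ multiplicity Fin._≟_ (tabulate f) P
    countFin-tabulate zero    f P = refl
    countFin-tabulate (suc k) f P with f Fin.zero Fin.≟ P
    ... | yes _ = cong suc (countFin-tabulate k (f ∘ Fin.suc) P)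
    ... | no  _ = countFin-tabulate k (f ∘ Fin.suc) P

    wtA≡listWeight : ∀ i w → wtA D R λ′ i w ≡ listWeight (tabulate (ρ D i w))
    wtA≡listWeight i w = weight-cong (countFin-tabulate n (ρ D i w))

    residues : ℤ → List (Fin n)
    residues i = Windows.window (vtx n) i n

    residues-↭ : ∀ i j → residues i ↭ residues j
    residues-↭ = Windows.window-↭ (vtx n) n (vtx-periodic n)

    corner-subst : ∀ {a b} (a≡b : a ≡ b) x → corner b (≡.subst (Fin ∘ deg) a≡b x) ≡ corner a x
    corner-subst refl x = refl

    ρ-↭ : ∀ i j w u → IsShift D i j w u → tabulate (ρ D i w) ↭ tabulate (ρ D j u)
    ρ-↭ i j w u w~u = tabulate-↭-byKey Fin._≟_ (vtx n ∘ pos i) (vtx n ∘ pos j) (ρ D i w) (ρ D j u)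
      (residues-↭ i j)
      (λ t t′ e → ≡.trans (≡.sym (corner-subst e (w t))) (cong (corner _) (w~u t t′ e)))

    wtA-shift : ∀ i j w u → IsShift D i j w u → wtA D R λ′ i w ≈ wtA D R λ′ j u
    wtA-shift i j w u w~u = begin
      wtA D R λ′ i w                  ≡⟨ wtA≡listWeight i w ⟩
      listWeight (tabulate (ρ D i w)) ≈⟨ listWeight-↭ (ρ-↭ i j w u w~u) ⟩
      listWeight (tabulate (ρ D j u)) ≡⟨ wtA≡listWeight j u ⟨
      wtA D R λ′ j u                  ∎
      where open import Relation.Binary.Reasoning.Setoid setoid

    cornersAt : Fin n → Family (Fin nsub)
    cornersAt a = deg a , corner a

    sum-wtA≈sumChoices : ∀ i → sumList R (map (wtA D R λ′ i) (allM D i))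
                               ≈ sumChoices (map cornersAt (residues i)) listWeight
    sum-wtA≈sumChoices i = trans
      (sumList-allChoices n (cornersAt ∘ vtx n ∘ pos i) (wtA D R λ′ i) listWeight
                          (reflexive ∘ wtA≡listWeight i))
      (reflexive (cong (λ ss → sumChoices ss listWeight)
                       (≡.sym (List.map-tabulate (vtx n ∘ pos {n} i) cornersAt))))

    sum-wtA-independent : ∀ i j → sumList R (map (wtA D R λ′ i) (allM D i))
                                ≈ sumList R (map (wtA D R λ′ j) (allM D j))
    sum-wtA-independent i j = begin
      sumList R (map (wtA D R λ′ i) (allM D i))            ≈⟨ sum-wtA≈sumChoices i ⟩
      sumChoices (map cornersAt (residues i)) listWeight  ≈⟨ sumChoices-↭ listWeight-↭
                                                                          (map⁺ cornersAt (residues-↭ i j)) ⟩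
      sumChoices (map cornersAt (residues j)) listWeight  ≈⟨ sum-wtA≈sumChoices j ⟨
      sumList R (map (wtA D R λ′ j) (allM D j))            ∎
      where open import Relation.Binary.Reasoning.Setoid setoid

lemma7p4 : {c ℓ : Level} (n : ℕ) .{{_ : NonZero n}} (ps : List ℕ) (D : Dissection n ps)
           (R : CommutativeRing c ℓ) (λ' : ℕ → CommutativeRing.Carrier R)
           (m : ℤ → ℤ → CommutativeRing.Carrier R) → RealizedFrieze R D λ' m →
           ((i j : ℤ) (w : M D i) (u : M D j) → IsShift D i j w u →
             CommutativeRing._≈_ R (wtA D R λ' i w) (wtA D R λ' j u))
           × ((i j : ℤ) → CommutativeRing._≈_ R
               (sumList R (map (wtA D R λ' i) (allM D i)))
               (sumList R (map (wtA D R λ' j) (allM D j))))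
lemma7p4 n ps D R λ' m _ = wtA-shift D R λ' , sum-wtA-independent D R λ'
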